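{- Let $x\in\{0,1\}^w$ and $\sigma\in\mathcal S_w$ be uniformly random, and let $f_L,f_M,f_R:[2w]\to\{\alpha,\beta\}$ be uniformly random, all independent. Condition on the block $B=\mathrm{Block}(x,\sigma)$ being active and on the functions $(f_L,f_M,f_R)$. Then $\sigma(1)$ is uniformly distributed over $\mathrm{clean}(B)$.
   Context: A block $\mathrm{Block}(x,\sigma)$ has four layers, each a copy of $[2w]$ partitioned into groups $g^i_j=(a^i_j,b^i_j)$, $j\in[w]$. Its edges are: - $(a^1_j,a^2_{\sigma(j)})$ and $(b^1_j,b^2_{\sigma(j)})$; - between layers 2 and 3, for each $j$: $(a^2_j,a^3_j),(b^2_j,b^3_j)$ if $x_j=0$, and $(a^2_j,b^3_j),(b^2_j,a^3_j)$ if $x_j=1$; - $(a^3_j,a^4_{\sigma^{ -1}(j)})$ and $(b^3_j,b^4_{\sigma^{ -1}(j)})$. $\mathrm{clean}(B)$ is the set of $j\in[w]$ with $f_L(a^2_j)=f_L(b^2_j)=\beta$, $f_M(a^2_j)=f_M(b^2_j)=\alpha$, and $f_R(a^3_j)=f_R(b^3_j)=\beta$. It depends only on $(f_L,f_M,f_R)$. The block $B$ is active if $\sigma(1)\in\mathrm{clean}(B)$. -}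

module Defs where

open import Data.Nat using (ℕ; zero; suc; _+_)
open import Data.Bool using (Bool; true; false; _∧_)
open import Data.Fin using (Fin; zero; suc; _↑ˡ_; _↑ʳ_; _≟_)
open import Data.Fin.Properties using (all?)
open import Data.Fin.Subset using (Subset)
open import Data.Vec using (tabulate)
open import Data.List using (List; []; _∷_; [_]; map; concatMap; filter; length; allFin)
open import Data.Product using (_×_; _,_)
open import Function.Definitions using (Injective)
open import Relation.Binary.PropositionalEquality using (_≡_; refl)
open import Relation.Nullary using (Dec; yes; no; does)
open import Relation.Nullary.Decidable using (_→-dec_; map′)
open import Relation.Unary using (Pred; Decidable)
import Level

data AB : Set where
  α β : AB

_≟AB_ : (u v : AB) → Dec (u ≡ v)
α ≟AB α = yes refl
α ≟AB β = no (λ ())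
β ≟AB α = no (λ ())
β ≟AB β = yes refl

-- Each layer is a copy of [2w], represented as Fin (w + w), partitioned into
-- groups g_j = (a_j , b_j), j ∈ [w]; convention: a_j = j, b_j = w + j.
a : ∀ {w} → Fin w → Fin (w + w)
a {w} j = j ↑ˡ w

b : ∀ {w} → Fin w → Fin (w + w)
b {w} j = w ↑ʳ j

-- A permutation of [w]: an injective map Fin w → Fin w (bijective since finite).
IsPerm : ∀ {w} → (Fin w → Fin w) → Set
IsPerm σ = Injective _≡_ _≡_ σ

isPerm? : ∀ {w} (σ : Fin w → Fin w) → Dec (IsPerm σ)
isPerm? σ = map′ (λ h {i} {j} → h i j) (λ h i j → h {i} {j})
  (all? (λ i → all? (λ j → (σ i ≟ σ j) →-dec (i ≟ j))))

-- Block(x, σ): the data x ∈ {0,1}^w (1 = true) and σ ∈ S_w.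
record Block (w : ℕ) : Set where
  constructor Block⟨_,_⟩
  field
    x : Fin w → Bool
    σ : Fin w → Fin w

-- Edges of Block(x,σ) (between layer i and i+1; vertices of each layer are Fin (w + w)).
data Edge {w : ℕ} (B : Block w) : ℕ → Fin (w + w) → Fin (w + w) → Set where
  e12a : ∀ j → Edge B 1 (a j) (a (Block.σ B j))
  e12b : ∀ j → Edge B 1 (b j) (b (Block.σ B j))
  e23a0 : ∀ j → Block.x B j ≡ false → Edge B 2 (a j) (a j)
  e23b0 : ∀ j → Block.x B j ≡ false → Edge B 2 (b j) (b j)
  e23a1 : ∀ j → Block.x B j ≡ true → Edge B 2 (a j) (b j)
  e23b1 : ∀ j → Block.x B j ≡ true → Edge B 2 (b j) (a j)
  e34a : ∀ j k → Block.σ B k ≡ j → Edge B 3 (a j) (a k)   -- k = σ⁻¹(j)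
  e34b : ∀ j k → Block.σ B k ≡ j → Edge B 3 (b j) (b k)

isClean : ∀ {w} (fL fM fR : Fin (w + w) → AB) → Fin w → Bool
isClean fL fM fR j =
  does (fL (a j) ≟AB β) ∧ does (fL (b j) ≟AB β) ∧
  does (fM (a j) ≟AB α) ∧ does (fM (b j) ≟AB α) ∧
  does (fR (a j) ≟AB β) ∧ does (fR (b j) ≟AB β)

clean : ∀ {w} (fL fM fR : Fin (w + w) → AB) → Subset w
clean fL fM fR = tabulate (isClean fL fM fR)

open import Data.Fin.Subset using (_∈_)
open import Data.Fin.Subset.Properties using (_∈?_)

-- B is active iff σ(1) ∈ clean(B); here [w] = Fin (suc n) and 1 ↦ zero.
Active : ∀ {n} (fL fM fR : Fin (suc n + suc n) → AB) → Block (suc n) → Set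
Active fL fM fR B = Block.σ B zero ∈ clean fL fM fR

active? : ∀ {n} (fL fM fR : Fin (suc n + suc n) → AB) → Decidable (Active fL fM fR)
active? fL fM fR B = Block.σ B zero ∈? clean fL fM fR

allFuns : ∀ {A : Set} n → List A → List (Fin n → A)
allFuns zero xs = [ (λ ()) ]
allFuns (suc n) xs =
  concatMap (λ v → map (λ f → λ { zero → v ; (suc i) → f i }) (allFuns n xs)) xs

-- The sample space for (x, σ): all of {0,1}^w × S_w (uniform measure).
allPerms : ∀ w → List (Fin w → Fin w)
allPerms w = filter isPerm? (allFuns w (allFin w))

allBlocks : ∀ w → List (Block w)
allBlocks w = concatMap (λ x → map (λ σ → Block⟨ x , σ ⟩) (allPerms w))
                        (allFuns w (true ∷ false ∷ []))

count : ∀ {w} {P : Pred (Block w) Level.zero} → Decidable P → ℕ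
count {w} P? = length (filter P? (allBlocks w))

ActiveAt : ∀ {n} (fL fM fR : Fin (suc n + suc n) → AB) → Fin (suc n) → Block (suc n) → Set
ActiveAt fL fM fR j B = Active fL fM fR B × Block.σ B zero ≡ j

activeAt? : ∀ {n} (fL fM fR : Fin (suc n + suc n) → AB) (j : Fin (suc n)) → Decidable (ActiveAt fL fM fR j)
activeAt? fL fM fR j B with active? fL fM fR B | Block.σ B zero ≟ j
... | yes p | yes q = yes (p , q)
... | no ¬p | _ = no (λ { (p , _) → ¬p p })
... | _ | no ¬q = no (λ { (_ , q) → ¬q q })

-- Every event involved depends on the block only through σ, so each count of blocks is the
-- number of bit vectors x times a count of permutations. Post-composition with the
-- transposition (j k) maps the permutations with σ 0 = j bijectively onto those with σ 0 = k,
-- so their number N does not depend on j. Hence N·2^w blocks are active with σ 0 = j when j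
-- is clean and none when it is not, while N·|clean|·2^w blocks are active.
module Submission where

open import Defs
open import Algebra.Properties.CommutativeSemigroup using (interchange)
import Algebra.Properties.CommutativeMonoid.Sum as CommutativeMonoidSum
open import Data.Bool using (true; false; if_then_else_)
open import Data.Fin using (Fin; zero; suc; _≟_)
open import Data.Fin.Permutation using (Permutation′; _⟨$⟩ʳ_; _⟨$⟩ˡ_; inverseˡ; transpose)
open import Data.Fin.Subset using (Subset; inside; outside; _∈_; _∉_; ∣_∣)
open import Data.Fin.Subset.Properties using (_∈?_)
open import Data.List using (List; []; _∷_; _++_; map; concatMap; filter; length; allFin; tabulate)
open import Data.List.Properties using (map-++; map-∘; map-cong; filter-none)
open import Data.List.Relation.Unary.All using (universal)
open import Data.Nat using (ℕ; zero; suc; _+_; _*_; _<_)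
open import Data.Nat.ListAction using (sum)
open import Data.Nat.ListAction.Properties using (sum-++)
open import Data.Nat.Properties
  using (+-0-commutativeMonoid; +-commutativeSemigroup; +-identityʳ; *-zeroʳ; *-distribˡ-+; *-assoc; *-comm)
open import Data.Product using (_×_; _,_; proj₂)
open import Data.Vec using ([]; _∷_)
open import Data.Vec.Functional using () renaming (_∷_ to _∷ᶠ_)
open import Function using (_∘_; id)
import Function.Construct.Composition as Composition
open import Level using (0ℓ)
open import Relation.Binary.Core using (_Preserves_⟶_)
open import Relation.Binary.PropositionalEquality
open import Relation.Nullary using (Dec; yes; no; does; contradiction)
open import Relation.Nullary.Decidable using (dec-true)
open import Relation.Unary using (Pred; Decidable; _≐_)

module FinSum = CommutativeMonoidSum +-0-commutativeMonoid

𝟙 : ∀ {p} {P : Set p} → Dec P → ℕ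
𝟙 P? = if does P? then 1 else 0

𝟙-⇔ : ∀ {p q} {P : Set p} {Q : Set q} (P? : Dec P) (Q? : Dec Q) → (P → Q) → (Q → P) → 𝟙 P? ≡ 𝟙 Q?
𝟙-⇔ (yes _) (yes _) _ _ = refl
𝟙-⇔ (no _)  (no _)  _ _ = refl
𝟙-⇔ (yes p) (no ¬q) f _ = contradiction (f p) ¬q
𝟙-⇔ (no ¬p) (yes q) _ g = contradiction (g q) ¬p

private
  variable
    A B : Set

∑ : List A → (A → ℕ) → ℕ
∑ xs F = sum (map F xs)

∑-cong : {F G : A → ℕ} (xs : List A) → (∀ x → F x ≡ G x) → ∑ xs F ≡ ∑ xs G
∑-cong xs F≗G = cong sum (map-cong F≗G xs)

∑-++ : (xs ys : List A) (F : A → ℕ) → ∑ (xs ++ ys) F ≡ ∑ xs F + ∑ ys F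
∑-++ xs ys F = trans (cong sum (map-++ F xs ys)) (sum-++ (map F xs) (map F ys))

∑-map : (g : B → A) (xs : List B) (F : A → ℕ) → ∑ (map g xs) F ≡ ∑ xs (F ∘ g)
∑-map g xs F = cong sum (sym (map-∘ xs))

∑-concatMap : (G : B → List A) (xs : List B) (F : A → ℕ) →
  ∑ (concatMap G xs) F ≡ ∑ xs (λ x → ∑ (G x) F)
∑-concatMap G []       F = refl
∑-concatMap G (x ∷ xs) F = trans (∑-++ (G x) (concatMap G xs) F) (cong (∑ (G x) F +_) (∑-concatMap G xs F))

∑-const : (xs : List A) (c : ℕ) → ∑ xs (λ _ → c) ≡ length xs * c
∑-const []       c = refl
∑-const (x ∷ xs) c = cong (c +_) (∑-const xs c)

∑-*ˡ : (c : ℕ) (xs : List A) (F : A → ℕ) → ∑ xs (λ x → c * F x) ≡ c * ∑ xs F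
∑-*ˡ c []       F = sym (*-zeroʳ c)
∑-*ˡ c (x ∷ xs) F = trans (cong (c * F x +_) (∑-*ˡ c xs F)) (sym (*-distribˡ-+ c (F x) (∑ xs F)))

∑-*ʳ : (c : ℕ) (xs : List A) (F : A → ℕ) → ∑ xs (λ x → F x * c) ≡ ∑ xs F * c
∑-*ʳ c xs F = trans (∑-cong xs (λ x → *-comm (F x) c)) (trans (∑-*ˡ c xs F) (*-comm c (∑ xs F)))

∑-+ : (xs : List A) (F G : A → ℕ) → ∑ xs (λ x → F x + G x) ≡ ∑ xs F + ∑ xs G
∑-+ []       F G = refl
∑-+ (x ∷ xs) F G = trans (cong (F x + G x +_) (∑-+ xs F G))
                         (interchange +-commutativeSemigroup (F x) (G x) (∑ xs F) (∑ xs G))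

∑-comm : (xs : List A) (ys : List B) (H : A → B → ℕ) →
  ∑ xs (λ x → ∑ ys (H x)) ≡ ∑ ys (λ y → ∑ xs (λ x → H x y))
∑-comm []       ys H = trans (sym (*-zeroʳ (length ys))) (sym (∑-const ys 0))
∑-comm (x ∷ xs) ys H = trans (cong (∑ ys (H x) +_) (∑-comm xs ys H))
                             (sym (∑-+ ys (H x) (λ y → ∑ xs (λ x′ → H x′ y))))

module _ {P : Pred A 0ℓ} (P? : Decidable P) where

  ∑-filter : (xs : List A) (F : A → ℕ) → ∑ (filter P? xs) F ≡ ∑ xs (λ x → 𝟙 (P? x) * F x)
  ∑-filter []       F = refl
  ∑-filter (x ∷ xs) F with does (P? x)
  ... | true  = cong₂ _+_ (sym (+-identityʳ (F x))) (∑-filter xs F)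
  ... | false = ∑-filter xs F

  length-filter≡∑ : (xs : List A) → length (filter P? xs) ≡ ∑ xs (𝟙 ∘ P?)
  length-filter≡∑ []       = refl
  length-filter≡∑ (x ∷ xs) with does (P? x)
  ... | true  = cong suc (length-filter≡∑ xs)
  ... | false = length-filter≡∑ xs

∑-tabulate : ∀ {m} (f : Fin m → A) (F : A → ℕ) → ∑ (tabulate f) F ≡ FinSum.sum (F ∘ f)
∑-tabulate {m = zero}  f F = refl
∑-tabulate {m = suc m} f F = cong (F (f zero) +_) (∑-tabulate (f ∘ suc) F)

∑-allFin : ∀ {m} (F : Fin m → ℕ) → ∑ (allFin m) F ≡ FinSum.sum F
∑-allFin = ∑-tabulate id

sum-𝟙-≟ : ∀ {m} (v : Fin m) (F : Fin m → ℕ) → FinSum.sum (λ k → 𝟙 (v ≟ k) * F k) ≡ F v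
sum-𝟙-≟ {suc m} zero    F =
  trans (cong₂ _+_ (+-identityʳ (F zero)) (FinSum.sum-replicate-zero m)) (+-identityʳ (F zero))
sum-𝟙-≟ {suc m} (suc v) F = sum-𝟙-≟ v (F ∘ suc)

sum-𝟙-∈ : ∀ {m} (S : Subset m) → FinSum.sum (λ k → 𝟙 (k ∈? S)) ≡ ∣ S ∣
sum-𝟙-∈ []            = refl
sum-𝟙-∈ (inside ∷ S)  = cong suc (sum-𝟙-∈ S)
sum-𝟙-∈ (outside ∷ S) = sum-𝟙-∈ S

length-preimage-uniform : ∀ {m} (g : A → Fin m) (S : Subset m) (xs : List A) {N : ℕ} →
  (∀ k → length (filter (λ x → g x ≟ k) xs) ≡ N) →
  length (filter (λ x → g x ∈? S) xs) ≡ N * ∣ S ∣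
length-preimage-uniform {m = m} g S xs {N} fibre = begin
  length (filter (λ x → g x ∈? S) xs)                           ≡⟨ length-filter≡∑ (λ x → g x ∈? S) xs ⟩
  ∑ xs (λ x → 𝟙 (g x ∈? S))                                      ≡⟨ ∑-cong xs split ⟩
  ∑ xs (λ x → ∑ (allFin m) (λ k → 𝟙 (g x ≟ k) * 𝟙 (k ∈? S)))    ≡⟨ ∑-comm xs (allFin m) _ ⟩
  ∑ (allFin m) (λ k → ∑ xs (λ x → 𝟙 (g x ≟ k) * 𝟙 (k ∈? S)))    ≡⟨ ∑-cong (allFin m) fibre-sum ⟩
  ∑ (allFin m) (λ k → N * 𝟙 (k ∈? S))                            ≡⟨ ∑-*ˡ N (allFin m) _ ⟩
  N * ∑ (allFin m) (λ k → 𝟙 (k ∈? S))                            ≡⟨ cong (N *_) card ⟩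
  N * ∣ S ∣                                                      ∎
  where
  open ≡-Reasoning
  split : ∀ x → 𝟙 (g x ∈? S) ≡ ∑ (allFin m) (λ k → 𝟙 (g x ≟ k) * 𝟙 (k ∈? S))
  split x = sym (trans (∑-allFin (λ k → 𝟙 (g x ≟ k) * 𝟙 (k ∈? S))) (sum-𝟙-≟ (g x) (λ k → 𝟙 (k ∈? S))))
  card : ∑ (allFin m) (λ k → 𝟙 (k ∈? S)) ≡ ∣ S ∣
  card = trans (∑-allFin (λ k → 𝟙 (k ∈? S))) (sum-𝟙-∈ S)
  fibre-sum : ∀ k → ∑ xs (λ x → 𝟙 (g x ≟ k) * 𝟙 (k ∈? S)) ≡ N * 𝟙 (k ∈? S)
  fibre-sum k = trans (∑-*ʳ (𝟙 (k ∈? S)) xs _)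
                      (cong (_* 𝟙 (k ∈? S)) (trans (sym (length-filter≡∑ (λ x → g x ≟ k) xs)) (fibre k)))

∑-allFuns-suc : ∀ {m} (L : List B) (E : (Fin (suc m) → B) → ℕ) → E Preserves _≗_ ⟶ _≡_ →
  ∑ (allFuns (suc m) L) E ≡ ∑ L (λ v → ∑ (allFuns m L) (λ f → E (v ∷ᶠ f)))
∑-allFuns-suc {m = m} L E E-ext = trans (∑-concatMap _ L E) (∑-cong L (λ v →
  trans (∑-map _ (allFuns m L) E) (∑-cong (allFuns m L) (λ f → E-ext λ { zero → refl ; (suc i) → refl }))))

∑-allFuns-∘ : (L : List B) (π : B → B) → (∀ F → ∑ L (F ∘ π) ≡ ∑ L F) →
  ∀ m (E : (Fin m → B) → ℕ) → E Preserves _≗_ ⟶ _≡_ →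
  ∑ (allFuns m L) (λ f → E (π ∘ f)) ≡ ∑ (allFuns m L) E
∑-allFuns-∘ L π L-inv zero    E E-ext = cong (_+ 0) (E-ext λ ())
∑-allFuns-∘ L π L-inv (suc m) E E-ext = begin
  ∑ (allFuns (suc m) L) (λ f → E (π ∘ f))
    ≡⟨ ∑-allFuns-suc L (λ f → E (π ∘ f)) (λ f≗g → E-ext (cong π ∘ f≗g)) ⟩
  ∑ L (λ v → ∑ (allFuns m L) (λ f → E (π ∘ (v ∷ᶠ f))))
    ≡⟨ ∑-cong L (λ v → ∑-cong (allFuns m L) (λ f → E-ext λ { zero → refl ; (suc i) → refl })) ⟩
  ∑ L (λ v → ∑ (allFuns m L) (λ f → E (π v ∷ᶠ (π ∘ f))))
    ≡⟨ ∑-cong L (λ v → ∑-allFuns-∘ L π L-inv m (λ f → E (π v ∷ᶠ f))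
                         (λ f≗g → E-ext λ { zero → refl ; (suc i) → f≗g i })) ⟩
  ∑ L (λ v → ∑ (allFuns m L) (λ f → E (π v ∷ᶠ f)))
    ≡⟨ L-inv (λ v → ∑ (allFuns m L) (λ f → E (v ∷ᶠ f))) ⟩
  ∑ L (λ v → ∑ (allFuns m L) (λ f → E (v ∷ᶠ f)))
    ≡⟨ ∑-allFuns-suc L E E-ext ⟨
  ∑ (allFuns (suc m) L) E ∎
  where open ≡-Reasoning

∑-allFin-permute : ∀ {m} (π : Permutation′ m) (F : Fin m → ℕ) → ∑ (allFin m) (F ∘ (π ⟨$⟩ʳ_)) ≡ ∑ (allFin m) F
∑-allFin-permute π F = trans (∑-allFin (F ∘ (π ⟨$⟩ʳ_))) (trans (sym (FinSum.sum-permute F π)) (sym (∑-allFin F)))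

⟨$⟩ʳ-injective : ∀ {w} (π : Permutation′ w) {i j : Fin w} → π ⟨$⟩ʳ i ≡ π ⟨$⟩ʳ j → i ≡ j
⟨$⟩ʳ-injective π {i} {j} πi≡πj = trans (sym (inverseˡ π)) (trans (cong (π ⟨$⟩ˡ_) πi≡πj) (inverseˡ π))

transpose-⟨$⟩ʳ-left : ∀ {w} (j k : Fin w) → transpose j k ⟨$⟩ʳ j ≡ k
transpose-⟨$⟩ʳ-left j k rewrite dec-true (j ≟ j) refl = refl

IsPerm-resp-≗ : ∀ {w} {σ τ : Fin w → Fin w} → σ ≗ τ → IsPerm σ → IsPerm τ
IsPerm-resp-≗ σ≗τ σ-inj {i} {j} τi≡τj = σ-inj (trans (σ≗τ i) (trans τi≡τj (sym (σ≗τ j))))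

IsPerm-∘ : ∀ {w} (π : Permutation′ w) {σ : Fin w → Fin w} → IsPerm σ → IsPerm ((π ⟨$⟩ʳ_) ∘ σ)
IsPerm-∘ π σ-inj = Composition.injective _≡_ _≡_ _≡_ σ-inj (⟨$⟩ʳ-injective π)

IsPerm-∘⁻ : ∀ {w} (π : Permutation′ w) {σ : Fin w → Fin w} → IsPerm ((π ⟨$⟩ʳ_) ∘ σ) → IsPerm σ
IsPerm-∘⁻ π πσ-inj σi≡σj = πσ-inj (cong (π ⟨$⟩ʳ_) σi≡σj)

nPermsSending : ∀ {w} → Fin w → Fin w → ℕ
nPermsSending {w} i j = length (filter (λ σ → σ i ≟ j) (allPerms w))

nPermsSending≡∑ : ∀ {w} (i j : Fin w) →
  nPermsSending i j ≡ ∑ (allFuns w (allFin w)) (λ σ → 𝟙 (isPerm? σ) * 𝟙 (σ i ≟ j))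
nPermsSending≡∑ {w} i j =
  trans (length-filter≡∑ (λ σ → σ i ≟ j) (allPerms w)) (∑-filter isPerm? (allFuns w (allFin w)) _)

nPermsSending-uniform : ∀ {w} (i j k : Fin w) → nPermsSending i j ≡ nPermsSending i k
nPermsSending-uniform {w} i j k = begin
  nPermsSending i j              ≡⟨ nPermsSending≡∑ i j ⟩
  ∑ funs (E j)                   ≡⟨ ∑-cong funs E-transpose ⟨
  ∑ funs (λ σ → E k (τ ∘ σ))     ≡⟨ ∑-allFuns-∘ (allFin w) τ (∑-allFin-permute π) w (E k) E-resp-≗ ⟩
  ∑ funs (E k)                   ≡⟨ nPermsSending≡∑ i k ⟨
  nPermsSending i k              ∎
  where
  open ≡-Reasoning
  funs = allFuns w (allFin w)
  π = transpose j k
  τ = π ⟨$⟩ʳ_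
  E : Fin w → (Fin w → Fin w) → ℕ
  E l σ = 𝟙 (isPerm? σ) * 𝟙 (σ i ≟ l)
  E-resp-≗ : E k Preserves _≗_ ⟶ _≡_
  E-resp-≗ σ≗ρ = cong₂ _*_ (𝟙-⇔ (isPerm? _) (isPerm? _) (IsPerm-resp-≗ σ≗ρ) (IsPerm-resp-≗ (sym ∘ σ≗ρ)))
                           (cong (λ l → 𝟙 (l ≟ k)) (σ≗ρ i))
  E-transpose : ∀ σ → E k (τ ∘ σ) ≡ E j σ
  E-transpose σ = cong₂ _*_ (𝟙-⇔ (isPerm? (τ ∘ σ)) (isPerm? σ) (IsPerm-∘⁻ π) (IsPerm-∘ π))
    (𝟙-⇔ (τ (σ i) ≟ k) (σ i ≟ j) (λ τσi≡k → ⟨$⟩ʳ-injective π (trans τσi≡k (sym (transpose-⟨$⟩ʳ-left j k))))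
                                  (λ σi≡j → trans (cong τ σi≡j) (transpose-⟨$⟩ʳ-left j k)))

nBitVectors : ℕ → ℕ
nBitVectors w = length (allFuns w (true ∷ false ∷ []))

count-via-σ : ∀ {w} {P : Pred (Block w) 0ℓ} {Q : Pred (Fin w → Fin w) 0ℓ} (P? : Decidable P) (Q? : Decidable Q) →
  P ≐ (Q ∘ Block.σ) → count P? ≡ nBitVectors w * length (filter Q? (allPerms w))
count-via-σ {w} P? Q? (P⊆Qσ , Qσ⊆P) = begin
  count P?                                                          ≡⟨ length-filter≡∑ P? (allBlocks w) ⟩
  ∑ (allBlocks w) (𝟙 ∘ P?)                                          ≡⟨ ∑-concatMap _ bits _ ⟩
  ∑ bits (λ x → ∑ (map (λ σ → Block⟨ x , σ ⟩) (allPerms w)) (𝟙 ∘ P?)) ≡⟨ ∑-cong bits perms-sum ⟩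
  ∑ bits (λ _ → length (filter Q? (allPerms w)))                    ≡⟨ ∑-const bits _ ⟩
  nBitVectors w * length (filter Q? (allPerms w))                   ∎
  where
  open ≡-Reasoning
  bits = allFuns w (true ∷ false ∷ [])
  perms-sum : ∀ x → ∑ (map (λ σ → Block⟨ x , σ ⟩) (allPerms w)) (𝟙 ∘ P?) ≡ length (filter Q? (allPerms w))
  perms-sum x = trans (∑-map _ (allPerms w) (𝟙 ∘ P?))
               (trans (∑-cong (allPerms w) (λ σ → 𝟙-⇔ (P? _) (Q? σ) P⊆Qσ Qσ⊆P))
                      (sym (length-filter≡∑ Q? (allPerms w))))

module _ {n} (fL fM fR : Fin (suc n + suc n) → AB) where

  private
    cl = clean {suc n} fL fM fR

  count-activeAt-∈ : ∀ {j} → j ∈ cl → count (activeAt? fL fM fR j) ≡ nBitVectors (suc n) * nPermsSending zero j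
  count-activeAt-∈ {j} j∈cl = count-via-σ (activeAt? fL fM fR j) (λ σ → σ zero ≟ j)
    (proj₂ , λ σ0≡j → subst (_∈ cl) (sym σ0≡j) j∈cl , σ0≡j)

  count-activeAt-∉ : ∀ {j} → j ∉ cl → count (activeAt? fL fM fR j) ≡ 0
  count-activeAt-∉ {j} j∉cl = cong length (filter-none (activeAt? fL fM fR j)
    (universal (λ _ (σ0∈cl , σ0≡j) → j∉cl (subst (_∈ cl) σ0≡j σ0∈cl)) (allBlocks (suc n))))

  count-active : ∀ j → count (active? fL fM fR) ≡ nBitVectors (suc n) * (nPermsSending zero j * ∣ cl ∣)
  count-active j = trans (count-via-σ (active? fL fM fR) (λ σ → σ zero ∈? cl) (id , id))
    (cong (nBitVectors (suc n) *_)
      (length-preimage-uniform (λ σ → σ zero) cl (allPerms (suc n)) (λ k → nPermsSending-uniform zero k j)))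

lemma4p4 : (n : ℕ) (fL fM fR : Fin (suc n + suc n) → AB)
  → 0 < count (active? {n} fL fM fR)
  → (j : Fin (suc n))
  → (j ∈ clean {suc n} fL fM fR
       → count (activeAt? {n} fL fM fR j) * ∣ clean {suc n} fL fM fR ∣ ≡ count (active? {n} fL fM fR))
    × (j ∉ clean {suc n} fL fM fR → count (activeAt? {n} fL fM fR j) ≡ 0)
-- The identity also holds when no block is active.
lemma4p4 n fL fM fR _ j = count-activeAt-∈-scaled , count-activeAt-∉ fL fM fR
  where
  open ≡-Reasoning
  cl = clean {suc n} fL fM fR
  count-activeAt-∈-scaled : j ∈ cl → count (activeAt? fL fM fR j) * ∣ cl ∣ ≡ count (active? fL fM fR)
  count-activeAt-∈-scaled j∈cl = begin
    count (activeAt? fL fM fR j) * ∣ cl ∣                 ≡⟨ cong (_* ∣ cl ∣) (count-activeAt-∈ fL fM fR j∈cl) ⟩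
    nBitVectors (suc n) * nPermsSending zero j * ∣ cl ∣    ≡⟨ *-assoc (nBitVectors (suc n)) _ ∣ cl ∣ ⟩
    nBitVectors (suc n) * (nPermsSending zero j * ∣ cl ∣)  ≡⟨ count-active fL fM fR j ⟨
    count (active? fL fM fR)                               ∎
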